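{- Let $n=2^k$ with $k\ge1$. Every set-blocked clause with respect to $\mathrm{BPHP}_n$ all of whose variables belong to $\mathrm{var}(\mathrm{BPHP}_n)$ has pigeon-width $n+1$.
   Context: A literal is a variable $v$ or its negation $\bar v$. A clause is a nontautological set of literals; a formula is a finite set of clauses; $\mathrm{var}(\Gamma)$ is the set of variables of $\Gamma$. For a set $L$ of literals, $\bar L=\{\bar\ell:\ell\in L\}$. A clause $C$ is a set-blocked clause (SBC) with respect to a formula $\Gamma$ if there is a nonempty $L\subseteq C$ such that for every $D\in\Gamma$ with $D\cap\bar L\neq\varnothing$ and $D\cap L=\varnothing$, the set $(C\setminus L)\cup(D\setminus\bar L)$ is tautological. Bit pigeonhole principle: with variables $p^x_\ell$ for $x\in[n+1]$ (pigeons), $\ell\in[k]$, and writing "$v\neq0$" for the literal $v$ and "$v\neq1$" for $\bar v$, $\mathrm{BPHP}_n$ is the set of clauses $\bigvee_{\ell=1}^k (p^x_\ell\neq h_\ell)\vee\bigvee_{\ell=1}^k(p^y_\ell\neq h_\ell)$ over all $x,y\in[n+1]$ with $x\neq y$ and all $(h_1,\dots,h_k)\in\{0,1\}^k$. A pigeon $x$ is mentioned by a set of literals $L$ if some literal of some variable $p^x_\ell$ ($\ell\in[k]$) is in $L$; the pigeon-width of $L$ is the number of distinct pigeons it mentions. -}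

module Defs where

open import Data.Nat using (ℕ; zero; suc; _+_; _^_)
open import Data.Fin using (Fin)
open import Data.Fin.Properties using () renaming (_≟_ to _≟ᶠ_)
open import Data.Bool using (Bool; true; false; not; _∧_; _∨_; if_then_else_)
open import Data.Bool.Properties using () renaming (_≟_ to _≟ᵇ_)
open import Data.List using (List; map)
open import Data.Bool.ListAction using (any)
open import Data.Nat.ListAction using (sum)
open import Data.List using () renaming (allFin to allFinL)
open import Data.Product using (Σ; ∃; ∃-syntax; _×_; _,_)
open import Relation.Binary.PropositionalEquality using (_≡_; _≢_)
open import Relation.Nullary using (¬_; ⌊_⌋)

-- Variables p^x_ℓ of BPHP_n with n+1 pigeons (x : Fin (suc n)) and k bits (ℓ : Fin k).
-- A literal is a variable together with a sign: true = the variable v, false = its negation v̄.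
Lit : ℕ → ℕ → Set
Lit n k = Fin (suc n) × Fin k × Bool

LitSet : ℕ → ℕ → Set
LitSet n k = Lit n k → Bool

module _ {n k : ℕ} where

  _∈ˡ_ : Lit n k → LitSet n k → Set
  l ∈ˡ S = S l ≡ true

  neg : Lit n k → Lit n k
  neg (x , ℓ , s) = (x , ℓ , not s)

  Tautological : LitSet n k → Set
  Tautological S = ∃[ x ] ∃[ ℓ ] ((x , ℓ , true) ∈ˡ S × (x , ℓ , false) ∈ˡ S)

  IsClause : LitSet n k → Set
  IsClause C = ¬ Tautological C

  -- the BPHP clause ∨_ℓ (p^x_ℓ ≠ h_ℓ) ∨ ∨_ℓ (p^y_ℓ ≠ h_ℓ);
  -- "v ≠ 0" is the literal v (sign true), "v ≠ 1" is v̄ (sign false),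
  -- so the literal of p^z_ℓ has sign (not h_ℓ).
  bphpClause : Fin (suc n) → Fin (suc n) → (Fin k → Bool) → LitSet n k
  bphpClause x y h (z , ℓ , s) = (⌊ z ≟ᶠ x ⌋ ∨ ⌊ z ≟ᶠ y ⌋) ∧ ⌊ s ≟ᵇ not (h ℓ) ⌋

  InBPHP : LitSet n k → Set
  InBPHP D = ∃[ x ] ∃[ y ] ∃[ h ] (x ≢ y × (∀ l → D l ≡ bphpClause x y h l))

  SetBlocked : LitSet n k → Set
  SetBlocked C =
    Σ (LitSet n k) λ L →
      (∀ l → l ∈ˡ L → l ∈ˡ C) ×
      (∃[ l ] (l ∈ˡ L)) ×
      (∀ D → InBPHP D →
         (∃[ l ] (l ∈ˡ D × neg l ∈ˡ L)) →
         (¬ (∃[ l ] (l ∈ˡ D × l ∈ˡ L))) →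
         Tautological (λ l → (C l ∧ not (L l)) ∨ (D l ∧ not (L (neg l)))))

  mentions : LitSet n k → Fin (suc n) → Bool
  mentions S x = any (λ ℓ → S (x , ℓ , true) ∨ S (x , ℓ , false)) (allFinL k)

  pigeonWidth : LitSet n k → ℕ
  pigeonWidth S = sum (map (λ x → if mentions S x then 1 else 0) (allFinL (suc n)))

-- Let (x, ℓ₀, s₀) ∈ L and suppose C does not mention pigeon z. Send pigeon x to
-- the hole h that satisfies every literal of L at x and falsifies every other
-- literal of C at x, and take D to be the BPHP clause saying x and z do not both
-- sit in h. Then D meets L̄ in the complement of (x, ℓ₀, s₀) and misses L, so set
-- blockedness makes (C ∖ L) ∪ (D ∖ L̄) tautological. But C ∖ L and D are
-- consistent, D lives on pigeons x and z, C is silent on z, and at x the choice of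
-- h makes D ∖ L̄ agree with C ∖ L. Hence every pigeon is mentioned.
module Submission where

open import Defs
open import Data.Nat using (ℕ; suc; _+_; _≤_; _^_)
open import Data.Fin using (Fin)
open import Data.Fin.Properties using () renaming (_≟_ to _≟ᶠ_)
open import Data.Bool using (Bool; true; false; not; _∧_; _∨_; if_then_else_)
open import Data.Bool.Properties
  using (∧-conicalˡ; ∧-conicalʳ; ∨-zeroʳ; not-involutive; not-injective; not-¬)
  renaming (_≟_ to _≟ᵇ_)
open import Data.List using (List; []; _∷_; map; length; allFin)
open import Data.List.Properties using (length-tabulate)
open import Data.List.Relation.Unary.Any using (here; there)
open import Data.List.Membership.Propositional using (_∈_)
open import Data.List.Membership.Propositional.Properties using (∈-allFin)
open import Data.Bool.ListAction using (any)
open import Data.Nat.ListAction using (sum)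
open import Data.Product using (∃-syntax; _×_; _,_)
open import Data.Sum using (_⊎_; inj₁; inj₂)
open import Data.Empty using (⊥-elim)
open import Relation.Binary.PropositionalEquality
  using (_≡_; _≢_; refl; sym; trans; cong; cong₂; subst; module ≡-Reasoning)
open import Relation.Nullary using (¬_; yes; no; contradiction)

∨-true⁻ : ∀ {a b} → a ∨ b ≡ true → a ≡ true ⊎ b ≡ true
∨-true⁻ {true}  _ = inj₁ refl
∨-true⁻ {false} e = inj₂ e

any-true : ∀ {A : Set} (p : A → Bool) {a} {xs : List A} → a ∈ xs → p a ≡ true → any p xs ≡ true
any-true p {xs = _ ∷ xs} (here refl) e = cong (_∨ any p xs) e
any-true p {xs = x ∷ _} (there a∈xs) e = trans (cong (p x ∨_) (any-true p a∈xs e)) (∨-zeroʳ (p x))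

sum-map-ones : ∀ {A : Set} {f : A → ℕ} → (∀ a → f a ≡ 1) → (xs : List A) → sum (map f xs) ≡ length xs
sum-map-ones f≡1 []       = refl
sum-map-ones f≡1 (x ∷ xs) = cong₂ _+_ (f≡1 x) (sum-map-ones f≡1 xs)

module _ {n k : ℕ} where

  _⊆ˡ_ : LitSet n k → LitSet n k → Set
  A ⊆ˡ B = ∀ l → l ∈ˡ A → l ∈ˡ B

  _∪ˡ_ : LitSet n k → LitSet n k → LitSet n k
  (A ∪ˡ B) l = A l ∨ B l

  _∖ˡ_ : LitSet n k → LitSet n k → LitSet n k
  (A ∖ˡ B) l = A l ∧ not (B l)

  complement : LitSet n k → LitSet n k
  complement L l = L (neg l)

  ∖ˡ-⊆ : ∀ A B → (A ∖ˡ B) ⊆ˡ A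
  ∖ˡ-⊆ A B l = ∧-conicalˡ _ _

  ∖ˡ-∉ : ∀ A B l → l ∈ˡ (A ∖ˡ B) → B l ≡ false
  ∖ˡ-∉ A B l e = not-injective (∧-conicalʳ _ _ e)

  taut-mono : ∀ {A B} → A ⊆ˡ B → Tautological A → Tautological B
  taut-mono A⊆B (x , ℓ , t , f) = x , ℓ , A⊆B _ t , A⊆B _ f

  taut-∪ˡ : ∀ A B → Tautological (A ∪ˡ B) →
            Tautological A ⊎ Tautological B ⊎ ∃[ l ] (l ∈ˡ A × neg l ∈ˡ B)
  taut-∪ˡ A B (x , ℓ , t , f) with ∨-true⁻ t | ∨-true⁻ f
  ... | inj₁ At | inj₁ Af = inj₁ (x , ℓ , At , Af)
  ... | inj₂ Bt | inj₂ Bf = inj₂ (inj₁ (x , ℓ , Bt , Bf))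
  ... | inj₁ At | inj₂ Bf = inj₂ (inj₂ ((x , ℓ , true) , At , Bf))
  ... | inj₂ Bt | inj₁ Af = inj₂ (inj₂ ((x , ℓ , false) , Af , Bt))

  bphpClause-∈ : ∀ (x y : Fin (suc n)) (h : Fin k → Bool) {z ℓ s} → (z , ℓ , s) ∈ˡ bphpClause x y h →
                 (z ≡ x ⊎ z ≡ y) × s ≡ not (h ℓ)
  bphpClause-∈ x y h {z} {ℓ} {s} e with z ≟ᶠ x | z ≟ᶠ y | s ≟ᵇ not (h ℓ)
  ... | yes z≡x | _       | yes s≡ = inj₁ z≡x , s≡
  ... | no _    | yes z≡y | yes s≡ = inj₂ z≡y , s≡
  ... | yes _   | _       | no _   = contradiction (sym e) λ ()
  ... | no _    | yes _   | no _   = contradiction (sym e) λ ()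
  ... | no _    | no _    | _      = contradiction (sym e) λ ()

  bphpClause-∋ : ∀ (x y : Fin (suc n)) (h : Fin k → Bool) {ℓ} → (x , ℓ , not (h ℓ)) ∈ˡ bphpClause x y h
  bphpClause-∋ x y h {ℓ} with x ≟ᶠ x | not (h ℓ) ≟ᵇ not (h ℓ)
  ... | yes _   | yes _   = refl
  ... | no x≢x  | _       = contradiction refl x≢x
  ... | yes _   | no s≢s  = contradiction refl s≢s

  bphpClause-isClause : ∀ (x y : Fin (suc n)) (h : Fin k → Bool) → IsClause (bphpClause x y h)
  bphpClause-isClause x y h (w , ℓ , t , f)
    with bphpClause-∈ x y h {w} {ℓ} t | bphpClause-∈ x y h {w} {ℓ} f
  ... | _ , t≡ | _ , f≡ = contradiction (trans t≡ (sym f≡)) λ ()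

  ∈⇒mentions : ∀ (S : LitSet n k) {z ℓ} s → (z , ℓ , s) ∈ˡ S → mentions S z ≡ true
  ∈⇒mentions S {z} {ℓ} s e = any-true _ (∈-allFin ℓ) (either s e)
    where
    either : ∀ s → (z , ℓ , s) ∈ˡ S → S (z , ℓ , true) ∨ S (z , ℓ , false) ≡ true
    either true  e = cong (_∨ S (z , ℓ , false)) e
    either false e = trans (cong (S (z , ℓ , true) ∨_) e) (∨-zeroʳ _)

  pigeonWidth-full : ∀ (S : LitSet n k) → (∀ z → mentions S z ≡ true) → pigeonWidth S ≡ suc n
  pigeonWidth-full S all = begin
    pigeonWidth S            ≡⟨ sum-map-ones (λ z → cong (λ b → if b then 1 else 0) (all z)) (allFin (suc n)) ⟩
    length (allFin (suc n))  ≡⟨ length-tabulate (λ z → z) ⟩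
    suc n                    ∎
    where open ≡-Reasoning

  module Resolution {C L : LitSet n k} (C-isClause : IsClause C) (L⊆C : L ⊆ˡ C) where

    hole : Fin (suc n) → Fin k → Bool
    hole x ℓ = if C (x , ℓ , true) then L (x , ℓ , true) else not (L (x , ℓ , false))

    hole-satisfies-L : ∀ {x ℓ} s → (x , ℓ , s) ∈ˡ L → hole x ℓ ≡ s
    hole-satisfies-L {x} {ℓ} s x∈L with C (x , ℓ , true) in x∈C | s
    ... | true  | true  = x∈L
    ... | true  | false = contradiction (x , ℓ , x∈C , L⊆C _ x∈L) C-isClause
    ... | false | true  = contradiction (trans (sym (L⊆C _ x∈L)) x∈C) λ ()
    ... | false | false = cong not x∈L

    hole-falsifies-C∖L : ∀ {x ℓ} s → (x , ℓ , s) ∈ˡ (C ∖ˡ L) → hole x ℓ ≡ not s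
    hole-falsifies-C∖L {x} {ℓ} s x∈C∖L with C (x , ℓ , true) in x∈C | s
    ... | true  | true  = ∖ˡ-∉ C L _ x∈C∖L
    ... | true  | false = contradiction (x , ℓ , x∈C , ∖ˡ-⊆ C L _ x∈C∖L) C-isClause
    ... | false | true  = contradiction (trans (sym (∖ˡ-⊆ C L _ x∈C∖L)) x∈C) λ ()
    ... | false | false = cong not (∖ˡ-∉ C L _ x∈C∖L)

    module _ {x z : Fin (suc n)} (z∉C : ∀ {ℓ s} → ¬ (z , ℓ , s) ∈ˡ C) where

      private
        D : LitSet n k
        D = bphpClause x z (hole x)

      bphpClause-meets-complement : ∀ {ℓ s} → (x , ℓ , s) ∈ˡ L →
                                    ∃[ l ] (l ∈ˡ D × neg l ∈ˡ L)
      bphpClause-meets-complement {ℓ} {s} x∈L =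
          (x , ℓ , not s)
        , subst (λ t → (x , ℓ , not t) ∈ˡ D) (hole-satisfies-L s x∈L) (bphpClause-∋ x z (hole x))
        , subst (λ t → (x , ℓ , t) ∈ˡ L) (sym (not-involutive s)) x∈L

      bphpClause-disjoint : ¬ (∃[ l ] (l ∈ˡ D × l ∈ˡ L))
      bphpClause-disjoint ((w , ℓ , s) , w∈D , w∈L) with bphpClause-∈ x z (hole x) {w} {ℓ} w∈D
      ... | inj₂ refl , _   = z∉C (L⊆C _ w∈L)
      ... | inj₁ refl , s≡ = not-¬ refl (trans s≡ (cong not (hole-satisfies-L s w∈L)))

      resolvent-isClause : IsClause ((C ∖ˡ L) ∪ˡ (D ∖ˡ complement L))
      resolvent-isClause taut with taut-∪ˡ (C ∖ˡ L) (D ∖ˡ complement L) taut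
      ... | inj₁ taut-C∖L       = C-isClause (taut-mono (∖ˡ-⊆ C L) taut-C∖L)
      ... | inj₂ (inj₁ taut-D∖L̄) =
        bphpClause-isClause x z (hole x) (taut-mono (∖ˡ-⊆ D (complement L)) taut-D∖L̄)
      ... | inj₂ (inj₂ ((w , ℓ , s) , w∈C∖L , w̄∈D∖L̄))
        with bphpClause-∈ x z (hole x) {w} {ℓ} (∖ˡ-⊆ D (complement L) _ w̄∈D∖L̄)
      ...   | inj₂ refl , _    = z∉C (∖ˡ-⊆ C L _ w∈C∖L)
      ...   | inj₁ refl , ¬s≡ = not-¬ refl (trans ¬s≡ (cong not (hole-falsifies-C∖L s w∈C∖L)))

  setBlocked⇒mentions : ∀ {C : LitSet n k} → IsClause C → SetBlocked C → ∀ z → mentions C z ≡ true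
  setBlocked⇒mentions {C} C-isClause (L , L⊆C , ((x , ℓ , s) , x∈L) , blocked) z
    with mentions C z in z-unmentioned
  ... | true  = refl
  ... | false = ⊥-elim (resolvent-isClause z∉C
                  (blocked (bphpClause x z (hole x))
                           (x , z , hole x , x≢z , λ _ → refl)
                           (bphpClause-meets-complement z∉C x∈L)
                           (bphpClause-disjoint z∉C)))
    where
    open Resolution C-isClause L⊆C

    z∉C : ∀ {ℓ s} → ¬ (z , ℓ , s) ∈ˡ C
    z∉C {s = s} z∈C = contradiction (trans (sym (∈⇒mentions C s z∈C)) z-unmentioned) λ ()

    x≢z : x ≢ z
    x≢z refl = z∉C (L⊆C _ x∈L)

lemma17 : (k : ℕ) → 1 ≤ k → (C : LitSet (2 ^ k) k) →
          IsClause C → SetBlocked C → pigeonWidth C ≡ suc (2 ^ k)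
lemma17 k _ C C-isClause C-blocked =
  pigeonWidth-full C (setBlocked⇒mentions C-isClause C-blocked)
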